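{- Let $(a_n)_{n\in\mathbf{N}}$ be a sequence in $\mathcal{C}$ with palindromic length sequence $pl=pl_a$. Then for all $k\ge0$: $pl(4k+3)=pl(k)$; $pl(4k+2)=pl(4k+3)+1$; $pl(4k+1)\in\{pl(4k+3)+1,\ pl(4k+3)+2\}$; $pl(4k)\in\{pl(4k+3),\ pl(4k+3)+1,\ pl(4k+3)+2\}$.
   Context: A word is a palindrome if it equals its reversal; $|w|_{pal}$ is the least number of palindromes whose concatenation is $w$. For a sequence $(a_n)$, $pl_a(n)=|a_0a_1\cdots a_n|_{pal}$. The class $\mathcal{C}$: let $\Sigma$ be an alphabet with at least two letters and $a\in\Sigma$. For a bijection $g$ of $\Sigma$ and a word $u$, $g(u)$ is the letter-by-letter image. Let $(f_n)_{n\ge0}$ be bijections of $\Sigma$ and define $w_0=a$, $w_n=w_{n-1}f_{n-1}(w_{n-1})f_{n-1}(w_{n-1})w_{n-1}$ for $n>0$, with the requirement $f_n(w_n)\neq w_n$ for all $n\ge0$. The limit infinite sequence is in $\mathcal{C}$; $\mathcal{C}$ is the set of all such limits. -}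

module Defs where

open import Data.Nat using (ℕ; zero; suc; _+_; _*_; _≤_)
open import Data.Fin using (Fin)
open import Data.Fin.Permutation using (Permutation′; _⟨$⟩ʳ_)
open import Data.List using (List; []; _∷_; [_]; _++_; map; reverse; concat; length; tabulate)
open import Data.List.Relation.Unary.All using (All)
open import Data.Product using (Σ; _×_; ∃; ∃-syntax)
open import Relation.Binary.PropositionalEquality using (_≡_; _≢_)
open import Relation.Nullary using (¬_)

IsPalindrome : ∀ {A : Set} → List A → Set
IsPalindrome w = reverse w ≡ w

PalFactorisation : ∀ {A : Set} → List A → List (List A) → Set
PalFactorisation w ps = All IsPalindrome ps × concat ps ≡ w

PalLength : ∀ {A : Set} → List A → ℕ → Set
PalLength w k =
  (∃[ ps ] (PalFactorisation w ps × length ps ≡ k)) ×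
  (∀ ps → PalFactorisation w ps → k ≤ length ps)

prefix : ∀ {A : Set} → (ℕ → A) → ℕ → List A
prefix s n = tabulate {n = n} (λ i → s (Data.Fin.toℕ i))

PL : ∀ {A : Set} → (ℕ → A) → ℕ → ℕ → Set
PL s n k = PalLength (prefix s (suc n)) k

image : ∀ {m} → Permutation′ m → List (Fin m) → List (Fin m)
image g u = map (g ⟨$⟩ʳ_) u

wseq : ∀ {m} → Fin m → (ℕ → Permutation′ m) → ℕ → List (Fin m)
wseq a f zero = [ a ]
wseq a f (suc n) = wseq a f n ++ image (f n) (wseq a f n) ++ image (f n) (wseq a f n) ++ wseq a f n

-- s is in the class C over the alphabet Fin m: there are a letter a and bijections f_n
-- with f_n(w_n) ≠ w_n for all n, and s is the limit of the w_n (every w_n is a prefix of s).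
InC : ∀ {m} → (ℕ → Fin m) → Set
InC {m} s =
  Σ (Fin m) λ a → Σ (ℕ → Permutation′ m) λ f →
    (∀ n → image (f n) (wseq a f n) ≢ wseq a f n) ×
    (∀ n → prefix s (length (wseq a f n)) ≡ wseq a f n)

-- Write blocks s k = (s (4k), s (4k+1)). Every sequence s of the class is the image of blocks s under the
-- morphism (x , y) ↦ x y y x with x ≢ y, and blocks s lies again in the class (over the alphabet of pairs).
-- A palindrome of length at least 4 in s is therefore centred at a block boundary and, up to its two end
-- letters, is the image of a palindrome of blocks s. Optimal factorisations of prefixes of blocks s thus
-- unblock to factorisations of prefixes of s; conversely, by induction through blocks s, the palindromic
-- length grows by at most one across any palindromic factor. Hence the palindromic length of the prefix of
-- length n follows a recursion on the base-4 digits of n, and the corollary reduces to the fact that the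
-- values at k and k + 1 differ by at most one.

module Submission where

open import Defs

open import Data.Empty using (⊥-elim)
open import Data.Fin using (Fin)
open import Data.Fin.Permutation using (_⟨$⟩ʳ_; _⟨$⟩ˡ_; inverseˡ)
open import Data.List using (List; []; _∷_; [_]; _++_; map; length; concat; reverse; applyUpTo; applyDownFrom)
open import Data.List.Properties
  using (∷-injective; ∷-injectiveʳ; length-++; length-map; length-++-≤ˡ; concat-++; ++-identityʳ; reverse-applyUpTo)
open import Data.List.Relation.Unary.All using (All)
import Data.List.Relation.Unary.All as All
open import Data.List.Relation.Unary.All.Properties using (++⁺; map⁺)
open import Data.Nat using (ℕ; zero; suc; _+_; _*_; _∸_; _≤_; _<_; _⊓_; z≤n; s≤s; NonZero)
open import Data.Nat.DivMod using (_/_; _%_; m≡m%n+[m/n]*n; [m+kn]%n≡m%n; m<n⇒m%n≡m; m%n<n; m/n<m; m*n/n≡m; /-monoˡ-≤)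
open import Data.Nat.Divisibility using (_∣_; divides; _∣?_; ∣m+n∣m⇒∣n)
open import Data.Nat.Induction using (<-rec)
open import Data.Nat.Properties
open import Data.Nat.Tactic.RingSolver using (solve-∀; solve)
open import Data.Product using (_×_; _,_; proj₁; proj₂; ∃-syntax)
import Data.Product as Product
open import Data.Product.Properties using (×-≡,≡→≡)
open import Data.Sum using (_⊎_; inj₁; inj₂)
open import Relation.Binary.Definitions using (Tri; tri<; tri≈; tri>)
open import Relation.Binary.PropositionalEquality hiding ([_])
open import Relation.Nullary using (¬_; yes; no)
open import Relation.Nullary.Decidable using (from-no; True; toWitness)

-- Arithmetic modulo 4

data Mod4 : ℕ → Set where
  4k+0 : ∀ k → Mod4 (k * 4)
  4k+1 : ∀ k → Mod4 (1 + k * 4)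
  4k+2 : ∀ k → Mod4 (2 + k * 4)
  4k+3 : ∀ k → Mod4 (3 + k * 4)

mod4 : ∀ n → Mod4 n
mod4 0 = 4k+0 0
mod4 1 = 4k+1 0
mod4 2 = 4k+2 0
mod4 3 = 4k+3 0
mod4 (suc (suc (suc (suc n)))) with mod4 n
... | 4k+0 k = 4k+0 (suc k)
... | 4k+1 k = 4k+1 (suc k)
... | 4k+2 k = 4k+2 (suc k)
... | 4k+3 k = 4k+3 (suc k)

[r+k*4]%4≡r : ∀ r k → r < 4 → (r + k * 4) % 4 ≡ r
[r+k*4]%4≡r r k r<4 = trans ([m+kn]%n≡m%n r k 4) (m<n⇒m%n≡m r<4)

[r+k*4]/4≡k : ∀ r k → r < 4 → (r + k * 4) / 4 ≡ k
[r+k*4]/4≡k r k r<4 = sym (*-cancelʳ-≡ k _ 4 (+-cancelˡ-≡ r _ _ (begin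
  r + k * 4                         ≡⟨ m≡m%n+[m/n]*n (r + k * 4) 4 ⟩
  (r + k * 4) % 4 + (r + k * 4) / 4 * 4  ≡⟨ cong (_+ (r + k * 4) / 4 * 4) ([r+k*4]%4≡r r k r<4) ⟩
  r + (r + k * 4) / 4 * 4           ∎)))
  where open ≡-Reasoning

k<1+r+k*4 : ∀ r k → k < suc (r + k * 4)
k<1+r+k*4 r k = s≤s (≤-trans (m≤m*n k 4) (m≤n+m (k * 4) r))

≤-quotient : ∀ {I r P} → r < 4 → I * 4 ≤ r + P * 4 → I ≤ P
≤-quotient {I} {r} {P} r<4 le = subst₂ _≤_ (m*n/n≡m I 4) ([r+k*4]/4≡k r P r<4) (/-monoˡ-≤ 4 le)

shift≤ : ∀ {a b} k → {True (a ≤? b)} → a + k ≤ b + k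
shift≤ k {a≤b} = +-monoˡ-≤ k (toWitness a≤b)

4∣-residues : ∀ r r′ I J → 4 ∣ (r + I * 4) + (r′ + J * 4) → 4 ∣ r + r′
4∣-residues r r′ I J 4∣sum = ∣m+n∣m⇒∣n (subst (4 ∣_) (regroup r r′ I J) 4∣sum) (divides (I + J) refl)
  where
  regroup : ∀ r r′ I J → (r + I * 4) + (r′ + J * 4) ≡ (I + J) * 4 + (r + r′)
  regroup = solve-∀

data Mod4Mirror : ℕ → ℕ → Set where
  mirror00 : ∀ I J → Mod4Mirror (I * 4) (J * 4)
  mirror13 : ∀ I J → Mod4Mirror (1 + I * 4) (3 + J * 4)
  mirror22 : ∀ I J → Mod4Mirror (2 + I * 4) (2 + J * 4)
  mirror31 : ∀ I J → Mod4Mirror (3 + I * 4) (1 + J * 4)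

mod4Mirror : ∀ i j → 4 ∣ i + j → Mod4Mirror i j
mod4Mirror i j 4∣i+j with mod4 i | mod4 j
... | 4k+0 I | 4k+0 J = mirror00 I J
... | 4k+1 I | 4k+3 J = mirror13 I J
... | 4k+2 I | 4k+2 J = mirror22 I J
... | 4k+3 I | 4k+1 J = mirror31 I J
... | 4k+0 I | 4k+1 J = ⊥-elim (from-no (4 ∣? 1) (4∣-residues 0 1 I J 4∣i+j))
... | 4k+0 I | 4k+2 J = ⊥-elim (from-no (4 ∣? 2) (4∣-residues 0 2 I J 4∣i+j))
... | 4k+0 I | 4k+3 J = ⊥-elim (from-no (4 ∣? 3) (4∣-residues 0 3 I J 4∣i+j))
... | 4k+1 I | 4k+0 J = ⊥-elim (from-no (4 ∣? 1) (4∣-residues 1 0 I J 4∣i+j))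
... | 4k+1 I | 4k+1 J = ⊥-elim (from-no (4 ∣? 2) (4∣-residues 1 1 I J 4∣i+j))
... | 4k+1 I | 4k+2 J = ⊥-elim (from-no (4 ∣? 3) (4∣-residues 1 2 I J 4∣i+j))
... | 4k+2 I | 4k+0 J = ⊥-elim (from-no (4 ∣? 2) (4∣-residues 2 0 I J 4∣i+j))
... | 4k+2 I | 4k+1 J = ⊥-elim (from-no (4 ∣? 3) (4∣-residues 2 1 I J 4∣i+j))
... | 4k+2 I | 4k+3 J = ⊥-elim (from-no (4 ∣? 5) (4∣-residues 2 3 I J 4∣i+j))
... | 4k+3 I | 4k+0 J = ⊥-elim (from-no (4 ∣? 3) (4∣-residues 3 0 I J 4∣i+j))
... | 4k+3 I | 4k+2 J = ⊥-elim (from-no (4 ∣? 5) (4∣-residues 3 2 I J 4∣i+j))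
... | 4k+3 I | 4k+3 J = ⊥-elim (from-no (4 ∣? 6) (4∣-residues 3 3 I J 4∣i+j))

4∣1+t⇒t≡3 : ∀ t → t ≤ 6 → 4 ∣ suc t → t ≡ 3
4∣1+t⇒t≡3 0 _ 4∣ = ⊥-elim (from-no (4 ∣? 1) 4∣)
4∣1+t⇒t≡3 1 _ 4∣ = ⊥-elim (from-no (4 ∣? 2) 4∣)
4∣1+t⇒t≡3 2 _ 4∣ = ⊥-elim (from-no (4 ∣? 3) 4∣)
4∣1+t⇒t≡3 3 _ 4∣ = refl
4∣1+t⇒t≡3 4 _ 4∣ = ⊥-elim (from-no (4 ∣? 5) 4∣)
4∣1+t⇒t≡3 5 _ 4∣ = ⊥-elim (from-no (4 ∣? 6) 4∣)
4∣1+t⇒t≡3 6 _ 4∣ = ⊥-elim (from-no (4 ∣? 7) 4∣)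
4∣1+t⇒t≡3 (suc (suc (suc (suc (suc (suc (suc _))))))) (s≤s (s≤s (s≤s (s≤s (s≤s (s≤s ())))))) _

mirror-mod4 : ∀ p q X → suc (p + q) ≡ X * 4 → p % 4 + q % 4 ≡ 3 × suc (p / 4 + q / 4) ≡ X
mirror-mod4 p q X eq = r+r′≡3 , *-cancelʳ-≡ _ X 4 (trans (cong (λ t → suc t + (P + Q) * 4) (sym r+r′≡3)) eq′)
  where
  r = p % 4
  r′ = q % 4
  P = p / 4
  Q = q / 4
  regroup : ∀ r r′ P Q → suc ((r + P * 4) + (r′ + Q * 4)) ≡ (P + Q) * 4 + suc (r + r′)
  regroup = solve-∀
  eq′ : suc (r + r′) + (P + Q) * 4 ≡ X * 4
  eq′ = begin
    suc (r + r′) + (P + Q) * 4            ≡⟨ +-comm (suc (r + r′)) _ ⟩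
    (P + Q) * 4 + suc (r + r′)            ≡⟨ regroup r r′ P Q ⟨
    suc ((r + P * 4) + (r′ + Q * 4))      ≡⟨ cong₂ (λ x y → suc (x + y)) (m≡m%n+[m/n]*n p 4) (m≡m%n+[m/n]*n q 4) ⟨
    suc (p + q)                           ≡⟨ eq ⟩
    X * 4                                 ∎
    where open ≡-Reasoning
  r+r′≡3 : r + r′ ≡ 3
  r+r′≡3 = 4∣1+t⇒t≡3 (r + r′) (+-mono-≤ (≤-pred (m%n<n p 4)) (≤-pred (m%n<n q 4)))
    (∣m+n∣m⇒∣n (subst (4 ∣_) (trans (sym eq′) (+-comm (suc (r + r′)) _)) (divides X refl)) (divides (P + Q) refl))

blockSum : ∀ r r′ I J D → r + r′ ≡ 4 → (r + I * 4) + (r′ + J * 4) ≡ D * 4 → suc (I + J) ≡ D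
blockSum r r′ I J D r+r′≡4 eq = *-cancelʳ-≡ (suc (I + J)) D 4 (begin
  suc (I + J) * 4                 ≡⟨ cong (_+ (I + J) * 4) r+r′≡4 ⟨
  (r + r′) + (I + J) * 4          ≡⟨ regroup r r′ I J ⟩
  (r + I * 4) + (r′ + J * 4)      ≡⟨ eq ⟩
  D * 4                           ∎)
  where
  open ≡-Reasoning
  regroup : ∀ r r′ I J → (r + r′) + (I + J) * 4 ≡ (r + I * 4) + (r′ + J * 4)
  regroup = solve-∀

k<k*4 : ∀ {k} → 0 < k → k < k * 4
k<k*4 {k@(suc _)} _ = m<m*n k 4 (s≤s (s≤s z≤n))

-- The digit recursion

digitStep : ℕ → ℕ → ℕ → ℕ
digitStep 0 a b = a
digitStep 1 a b = suc a
digitStep 2 a b = 2 + (a ⊓ b)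
digitStep _ a b = suc b

digitStep-cong : ∀ r {a a′ b b′} → a ≡ a′ → (2 ≤ r → b ≡ b′) → digitStep r a b ≡ digitStep r a′ b′
digitStep-cong 0 a≡a′ _ = a≡a′
digitStep-cong 1 a≡a′ _ = cong suc a≡a′
digitStep-cong 2 a≡a′ b≡b′ = cong₂ (λ x y → 2 + (x ⊓ y)) a≡a′ (b≡b′ (s≤s (s≤s z≤n)))
digitStep-cong (suc (suc (suc r))) _ b≡b′ = cong suc (b≡b′ (s≤s (s≤s z≤n)))

-- The first argument is fuel; palLen below gives enough of it.
palLenFuel : ℕ → ℕ → ℕ
palLenFuel zero    n = 0
palLenFuel (suc f) n = digitStep (n % 4) (palLenFuel f (n / 4)) (palLenFuel f (suc (n / 4)))

-- Shown below to be the palindromic length of the prefix of length n, so that pl(n) = palLen (n + 1).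
palLen : ℕ → ℕ
palLen n = palLenFuel (suc n) n

palLenFuel-zero : ∀ f → palLenFuel f 0 ≡ 0
palLenFuel-zero zero    = refl
palLenFuel-zero (suc f) = palLenFuel-zero f

n/4<n : ∀ n → .{{NonZero n}} → n / 4 < n
n/4<n n = m/n<m n 4 (s≤s (s≤s z≤n))

1+n/4<n : ∀ n → 2 ≤ n % 4 → suc (n / 4) < n
1+n/4<n n 2≤n%4 = begin-strict
  suc (n / 4)        <⟨ s≤s (s≤s (m≤m*n (n / 4) 4)) ⟩
  2 + n / 4 * 4      ≤⟨ +-monoˡ-≤ (n / 4 * 4) 2≤n%4 ⟩
  n % 4 + n / 4 * 4  ≡⟨ m≡m%n+[m/n]*n n 4 ⟨
  n                  ∎
  where open ≤-Reasoning

palLenFuel-stable : ∀ f g n → n ≤ f → n ≤ g → palLenFuel (suc f) n ≡ palLenFuel (suc g) n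
palLenFuel-stable f g zero _ _ = trans (palLenFuel-zero (suc f)) (sym (palLenFuel-zero (suc g)))
palLenFuel-stable (suc f) (suc g) n@(suc _) n≤f n≤g = digitStep-cong (n % 4)
  (palLenFuel-stable f g (n / 4) (below (n/4<n n) n≤f) (below (n/4<n n) n≤g))
  (λ 2≤r → palLenFuel-stable f g (suc (n / 4)) (below (1+n/4<n n 2≤r) n≤f) (below (1+n/4<n n 2≤r) n≤g))
  where
  below : ∀ {m h} → m < n → n ≤ suc h → m ≤ h
  below m<n n≤h = ≤-pred (≤-trans m<n n≤h)

palLen-unfold : ∀ n → .{{NonZero n}} → palLen n ≡ digitStep (n % 4) (palLen (n / 4)) (palLen (suc (n / 4)))
palLen-unfold n@(suc m) = digitStep-cong (n % 4)
  (palLenFuel-stable m (n / 4) (n / 4) (≤-pred (n/4<n n)) ≤-refl)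
  (λ 2≤r → palLenFuel-stable m (suc (n / 4)) (suc (n / 4)) (≤-pred (1+n/4<n n 2≤r)) ≤-refl)

palLen-digit : ∀ r k → r < 4 → .{{NonZero (r + k * 4)}} →
  palLen (r + k * 4) ≡ digitStep r (palLen k) (palLen (suc k))
palLen-digit r k r<4 = begin
  palLen (r + k * 4)   ≡⟨ palLen-unfold (r + k * 4) ⟩
  digitStep ((r + k * 4) % 4) (palLen ((r + k * 4) / 4)) (palLen (suc ((r + k * 4) / 4)))
    ≡⟨ cong₂ (λ x y → digitStep x (palLen y) (palLen (suc y))) ([r+k*4]%4≡r r k r<4) ([r+k*4]/4≡k r k r<4) ⟩
  digitStep r (palLen k) (palLen (suc k)) ∎
  where open ≡-Reasoning

palLen-4k : ∀ k → palLen (k * 4) ≡ palLen k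
palLen-4k zero    = refl
palLen-4k (suc k) = palLen-digit 0 (suc k) (s≤s z≤n)

palLen-4k+1 : ∀ k → palLen (1 + k * 4) ≡ suc (palLen k)
palLen-4k+1 k = palLen-digit 1 k (s≤s (s≤s z≤n))

palLen-4k+2 : ∀ k → palLen (2 + k * 4) ≡ 2 + (palLen k ⊓ palLen (suc k))
palLen-4k+2 k = palLen-digit 2 k (s≤s (s≤s (s≤s z≤n)))

palLen-4k+3 : ∀ k → palLen (3 + k * 4) ≡ suc (palLen (suc k))
palLen-4k+3 k = palLen-digit 3 k (s≤s (s≤s (s≤s (s≤s z≤n))))

palLen-4k+2ˡ : ∀ k → palLen k ≤ palLen (suc k) → palLen (2 + k * 4) ≡ 2 + palLen k
palLen-4k+2ˡ k k≤k+1 = trans (palLen-4k+2 k) (cong (2 +_) (m≤n⇒m⊓n≡m k≤k+1))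

palLen-4k+2ʳ : ∀ k → palLen (suc k) ≤ palLen k → palLen (2 + k * 4) ≡ 2 + palLen (suc k)
palLen-4k+2ʳ k k+1≤k = trans (palLen-4k+2 k) (cong (2 +_) (m≥n⇒m⊓n≡n k+1≤k))

palLen-suc≤ : ∀ n → palLen (suc n) ≤ suc (palLen n)
palLen-suc≤ = <-rec _ step
  where
  step : ∀ n → (∀ {m} → m < n → palLen (suc m) ≤ suc (palLen m)) → palLen (suc n) ≤ suc (palLen n)
  step n ih with mod4 n
  ... | 4k+0 k rewrite palLen-4k+1 k | palLen-4k k = ≤-refl
  ... | 4k+1 k rewrite palLen-4k+2 k | palLen-4k+1 k = s≤s (s≤s (m⊓n≤m _ _))
  ... | 4k+2 k rewrite palLen-4k+3 k | palLen-4k+2 k =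
    s≤s (⊓-glb (≤-trans (ih (k<1+r+k*4 1 k)) (n≤1+n _)) (≤-trans (n≤1+n _) (n≤1+n _)))
  ... | 4k+3 k rewrite palLen-4k (suc k) | palLen-4k+3 k = ≤-trans (n≤1+n _) (n≤1+n _)

palLen≤suc : ∀ n → palLen n ≤ suc (palLen (suc n))
palLen≤suc = <-rec _ step
  where
  step : ∀ n → (∀ {m} → m < n → palLen m ≤ suc (palLen (suc m))) → palLen n ≤ suc (palLen (suc n))
  step n ih with mod4 n
  ... | 4k+0 k rewrite palLen-4k+1 k | palLen-4k k = ≤-trans (n≤1+n _) (n≤1+n _)
  ... | 4k+1 k rewrite palLen-4k+2 k | palLen-4k+1 k =
    s≤s (⊓-glb (≤-trans (n≤1+n _) (n≤1+n _)) (≤-trans (ih (k<1+r+k*4 0 k)) (n≤1+n _)))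
  ... | 4k+2 k rewrite palLen-4k+3 k | palLen-4k+2 k = s≤s (s≤s (m⊓n≤n _ _))
  ... | 4k+3 k rewrite palLen-4k (suc k) | palLen-4k+3 k = ≤-refl

-- Palindromic factors and blocks

private variable
  A : Set

-- s i ⋯ s (j ∸ 1) is a palindrome; positions p and q mirror each other when p + q + 1 ≡ i + j.
PalFactor : (ℕ → A) → ℕ → ℕ → Set
PalFactor s i j = ∀ p q → i ≤ p → i ≤ q → suc (p + q) ≡ i + j → s p ≡ s q

-- A factorisation of s i ⋯ s (j ∸ 1) into k nonempty palindromes.
data PalChain (s : ℕ → A) (i : ℕ) : ℕ → ℕ → Set where
  []   : PalChain s i i 0
  snoc : ∀ {m j k} → PalChain s i m k → m < j → PalFactor s m j → PalChain s i j (suc k)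

palFactor-inner : ∀ {s : ℕ → A} {i j} → PalFactor s i (suc j) → PalFactor s (suc i) j
palFactor-inner {i = i} {j} pal p q i<p i<q eq = pal p q (<⇒≤ i<p) (<⇒≤ i<q) (trans eq (sym (+-suc i j)))

palFactor-letter : ∀ {s : ℕ → A} m → PalFactor s m (suc m)
palFactor-letter {s = s} m p q m≤p m≤q eq = cong s (trans p≡m (sym q≡m))
  where
  p+q≡m+m : p + q ≡ m + m
  p+q≡m+m = suc-injective (trans eq (+-suc m m))
  p≡m : p ≡ m
  p≡m = ≤-antisym (+-cancelʳ-≤ m p m (≤-trans (+-monoʳ-≤ p m≤q) (≤-reflexive p+q≡m+m))) m≤p
  q≡m : q ≡ m
  q≡m = ≤-antisym (+-cancelˡ-≤ m q m (≤-trans (+-monoˡ-≤ q m≤p) (≤-reflexive p+q≡m+m))) m≤q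

blocks : (ℕ → A) → ℕ → A × A
blocks s k = s (k * 4) , s (1 + k * 4)

-- s is the image of blocks s under the morphism (x , y) ↦ x y y x, with x ≢ y.
record Blocked (s : ℕ → A) : Set where
  field
    letter-2 : ∀ k → s (2 + k * 4) ≡ s (1 + k * 4)
    letter-3 : ∀ k → s (3 + k * 4) ≡ s (k * 4)
    letters-distinct : ∀ k → s (k * 4) ≢ s (1 + k * 4)

blockLetter : ℕ → A × A → A
blockLetter 1 = proj₂
blockLetter 2 = proj₂
blockLetter _ = proj₁

blockLetter-mirror : ∀ {A : Set} r r′ → r + r′ ≡ 3 → blockLetter {A} r ≡ blockLetter r′
blockLetter-mirror 0 .3 refl = refl
blockLetter-mirror 1 .2 refl = refl
blockLetter-mirror 2 .1 refl = refl
blockLetter-mirror 3 .0 refl = refl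

PalBound : (ℕ → A) → ℕ → Set
PalBound s n = ∀ {i j} → i ≤ j → j < n → PalFactor s i j → palLen j ≤ suc (palLen i)

palChain-snocLetter : ∀ {s : ℕ → A} {i j k} → PalChain s i j k → PalChain s i (suc j) (suc k)
palChain-snocLetter chain = snoc chain (n<1+n _) (palFactor-letter _)

ShortChain : (ℕ → A) → ℕ → Set
ShortChain s n = ∃[ k ] PalChain s 0 n k × k ≤ palLen n

module _ {s : ℕ → A} (blocked : Blocked s) where
  open Blocked blocked

  blocked-letter : ∀ r k → r < 4 → s (r + k * 4) ≡ blockLetter r (blocks s k)
  blocked-letter 0 k _ = refl
  blocked-letter 1 k _ = refl
  blocked-letter 2 k _ = letter-2 k
  blocked-letter 3 k _ = letter-3 k
  blocked-letter (suc (suc (suc (suc _)))) k (s≤s (s≤s (s≤s (s≤s ()))))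

  blocked-at : ∀ p → s p ≡ blockLetter (p % 4) (blocks s (p / 4))
  blocked-at p = trans (cong s (m≡m%n+[m/n]*n p 4)) (blocked-letter (p % 4) (p / 4) (m%n<n p 4))

  palFactor-unblock : ∀ {I J} → PalFactor (blocks s) I J → PalFactor s (I * 4) (J * 4)
  palFactor-unblock {I} {J} pal p q I*4≤p I*4≤q eq = begin
    s p                                     ≡⟨ blocked-at p ⟩
    blockLetter (p % 4) (blocks s (p / 4))  ≡⟨ cong (blockLetter (p % 4)) same-block ⟩
    blockLetter (p % 4) (blocks s (q / 4))  ≡⟨ cong-app same-letter (blocks s (q / 4)) ⟩
    blockLetter (q % 4) (blocks s (q / 4))  ≡⟨ blocked-at q ⟨
    s q                                     ∎
    where
    open ≡-Reasoning
    residues = mirror-mod4 p q (I + J) (trans eq (sym (*-distribʳ-+ 4 I J)))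
    I≤ : ∀ {x} → I * 4 ≤ x → I ≤ x / 4
    I≤ {x} I*4≤x = subst (_≤ x / 4) (m*n/n≡m I 4) (/-monoˡ-≤ 4 I*4≤x)
    same-block : blocks s (p / 4) ≡ blocks s (q / 4)
    same-block = pal (p / 4) (q / 4) (I≤ I*4≤p) (I≤ I*4≤q) (proj₂ residues)
    same-letter : blockLetter (p % 4) ≡ blockLetter (q % 4)
    same-letter = blockLetter-mirror (p % 4) (q % 4) (proj₁ residues)

  palChain-unblock : ∀ {I J k} → PalChain (blocks s) I J k → PalChain s (I * 4) (J * 4) k
  palChain-unblock []                 = []
  palChain-unblock (snoc chain M<J pal) = snoc (palChain-unblock chain) (*-monoˡ-< 4 M<J) (palFactor-unblock pal)

  block-mirror : ∀ {i j P Q} → PalFactor s i j → suc (P + Q) * 4 ≡ i + j → i ≤ 2 + P * 4 → P < Q →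
                 blocks s P ≡ blocks s Q
  block-mirror {i} {j} {P} {Q} pal eq i≤ P<Q = cong₂ _,_
    (trans (sym (letter-3 P)) (pal (3 + P * 4) (Q * 4) (≤-trans i≤ (n≤1+n _)) i≤Q*4 (trans (x-mirror P Q) eq)))
    (trans (sym (letter-2 P)) (pal (2 + P * 4) (1 + Q * 4) i≤ (≤-trans i≤Q*4 (n≤1+n _)) (trans (y-mirror P Q) eq)))
    where
    i≤Q*4 : i ≤ Q * 4
    i≤Q*4 = ≤-trans i≤ (≤-trans (shift≤ (P * 4)) (*-monoˡ-≤ 4 P<Q))
    x-mirror : ∀ P Q → suc ((3 + P * 4) + Q * 4) ≡ suc (P + Q) * 4
    x-mirror = solve-∀
    y-mirror : ∀ P Q → suc ((2 + P * 4) + (1 + Q * 4)) ≡ suc (P + Q) * 4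
    y-mirror = solve-∀

  palFactor-block : ∀ {i j D I J} → PalFactor s i j → i + j ≡ D * 4 → I + J ≡ D → i ≤ 2 + I * 4 →
                    PalFactor (blocks s) I J
  palFactor-block {i} {j} {D} {I} {J} pal i+j≡D*4 I+J≡D i≤ P Q I≤P I≤Q eq = by-cases (<-cmp P Q)
    where
    inside : ∀ {X} → I ≤ X → i ≤ 2 + X * 4
    inside I≤X = ≤-trans i≤ (+-monoʳ-≤ 2 (*-monoˡ-≤ 4 I≤X))
    centre : ∀ X Y → suc (X + Y) ≡ I + J → suc (X + Y) * 4 ≡ i + j
    centre X Y eq = trans (cong (_* 4) (trans eq I+J≡D)) (sym i+j≡D*4)
    by-cases : Tri (P < Q) (P ≡ Q) (Q < P) → blocks s P ≡ blocks s Q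
    by-cases (tri< P<Q _ _)  = block-mirror pal (centre P Q eq) (inside I≤P) P<Q
    by-cases (tri≈ _ refl _) = refl
    by-cases (tri> _ _ Q<P)  = sym (block-mirror pal (centre Q P (trans (cong suc (+-comm Q P)) eq)) (inside I≤Q) Q<P)

  palFactor-length4 : ∀ i → PalFactor s i (4 + i) → 4 ∣ i + (4 + i)
  palFactor-length4 i pal with mod4 i
  ... | 4k+0 K = divides (suc (K + K)) (solve (K ∷ []))
  ... | 4k+1 K = ⊥-elim (letters-distinct K (begin
    s (K * 4)      ≡⟨ letter-3 K ⟨
    s (3 + K * 4)  ≡⟨ pal (2 + K * 4) (3 + K * 4) (shift≤ (K * 4)) (shift≤ (K * 4)) (solve (K ∷ [])) ⟨
    s (2 + K * 4)  ≡⟨ letter-2 K ⟩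
    s (1 + K * 4)  ∎))
    where open ≡-Reasoning
  ... | 4k+2 K = divides (suc (suc (K + K))) (solve (K ∷ []))
  ... | 4k+3 K = ⊥-elim (letters-distinct (suc K)
    (pal (4 + K * 4) (5 + K * 4) (shift≤ (K * 4)) (shift≤ (K * 4)) (solve (K ∷ []))))

  palFactor-length5 : ∀ i → ¬ PalFactor s i (5 + i)
  palFactor-length5 i pal with mod4 i
  ... | 4k+0 K = letters-distinct K (trans (sym (letter-3 K))
    (sym (pal (1 + K * 4) (3 + K * 4) (shift≤ (K * 4)) (shift≤ (K * 4)) (solve (K ∷ [])))))
  ... | 4k+1 K = letters-distinct (suc K) (begin
    s (4 + K * 4)  ≡⟨ pal (2 + K * 4) (4 + K * 4) (shift≤ (K * 4)) (shift≤ (K * 4)) (solve (K ∷ [])) ⟨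
    s (2 + K * 4)  ≡⟨ letter-2 K ⟩
    s (1 + K * 4)  ≡⟨ pal (1 + K * 4) (5 + K * 4) (shift≤ (K * 4)) (shift≤ (K * 4)) (solve (K ∷ [])) ⟩
    s (5 + K * 4)  ∎)
    where open ≡-Reasoning
  ... | 4k+2 K = letters-distinct K (begin
    s (K * 4)      ≡⟨ letter-3 K ⟨
    s (3 + K * 4)  ≡⟨ pal (3 + K * 4) (5 + K * 4) (shift≤ (K * 4)) (shift≤ (K * 4)) (solve (K ∷ [])) ⟩
    s (5 + K * 4)  ≡⟨ letter-2 (suc K) ⟨
    s (6 + K * 4)  ≡⟨ pal (2 + K * 4) (6 + K * 4) (shift≤ (K * 4)) (shift≤ (K * 4)) (solve (K ∷ [])) ⟨
    s (2 + K * 4)  ≡⟨ letter-2 K ⟩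
    s (1 + K * 4)  ∎)
    where open ≡-Reasoning
  ... | 4k+3 K = letters-distinct (suc K) (trans
    (pal (4 + K * 4) (6 + K * 4) (shift≤ (K * 4)) (shift≤ (K * 4)) (solve (K ∷ []))) (letter-2 (suc K)))

  -- Shrinking by one letter on each side keeps the centre, down to length 4 or 5.
  palFactor-centre : ∀ L i → PalFactor s i (4 + L + i) → 4 ∣ i + (4 + L + i)
  palFactor-centre 0 i pal = palFactor-length4 i pal
  palFactor-centre 1 i pal = ⊥-elim (palFactor-length5 i pal)
  palFactor-centre (suc (suc L)) i pal =
    subst (4 ∣_) (same-centre i L) (palFactor-centre L (suc i) inner)
    where
    inner : PalFactor s (suc i) (4 + L + suc i)
    inner = subst (PalFactor s (suc i)) (cong (4 +_) (sym (+-suc L i))) (palFactor-inner pal)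
    same-centre : ∀ i L → suc i + (4 + L + suc i) ≡ i + (4 + suc (suc L) + i)
    same-centre = solve-∀

  palLen-length2 : ∀ i → PalFactor s i (2 + i) → palLen (2 + i) ≤ suc (palLen i)
  palLen-length2 i pal with mod4 i
  ... | 4k+0 K = ⊥-elim (letters-distinct K (pal (K * 4) (1 + K * 4) ≤-refl (n≤1+n _) (solve (K ∷ []))))
  ... | 4k+1 K = begin
    palLen (3 + K * 4)        ≡⟨ palLen-4k+3 K ⟩
    suc (palLen (suc K))      ≤⟨ s≤s (palLen-suc≤ K) ⟩
    suc (suc (palLen K))      ≡⟨ cong suc (palLen-4k+1 K) ⟨
    suc (palLen (1 + K * 4))  ∎
    where open ≤-Reasoning
  ... | 4k+2 K = begin
    palLen (suc K * 4)                          ≡⟨ palLen-4k (suc K) ⟩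
    palLen (suc K)
      ≤⟨ ⊓-glb (≤-trans (palLen-suc≤ K) (shift≤ (palLen K))) (shift≤ (palLen (suc K))) ⟩
    3 + (palLen K ⊓ palLen (suc K))             ≡⟨ cong suc (palLen-4k+2 K) ⟨
    suc (palLen (2 + K * 4))                    ∎
    where open ≤-Reasoning
  ... | 4k+3 K = begin
    palLen (1 + suc K * 4)    ≡⟨ palLen-4k+1 (suc K) ⟩
    suc (palLen (suc K))      ≤⟨ n≤1+n _ ⟩
    suc (suc (palLen (suc K))) ≡⟨ cong suc (palLen-4k+3 K) ⟨
    suc (palLen (3 + K * 4))  ∎
    where open ≤-Reasoning

  palLen-length3 : ∀ i → PalFactor s i (3 + i) → palLen (3 + i) ≤ suc (palLen i)
  palLen-length3 i pal with mod4 i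
  ... | 4k+0 K = ⊥-elim (letters-distinct K
    (trans (pal (K * 4) (2 + K * 4) ≤-refl (shift≤ (K * 4)) (solve (K ∷ []))) (letter-2 K)))
  ... | 4k+1 K = begin
    palLen (suc K * 4)        ≡⟨ palLen-4k (suc K) ⟩
    palLen (suc K)            ≤⟨ ≤-trans (palLen-suc≤ K) (n≤1+n _) ⟩
    suc (suc (palLen K))      ≡⟨ cong suc (palLen-4k+1 K) ⟨
    suc (palLen (1 + K * 4))  ∎
    where open ≤-Reasoning
  ... | 4k+2 K = begin
    palLen (1 + suc K * 4)                      ≡⟨ palLen-4k+1 (suc K) ⟩
    suc (palLen (suc K))
      ≤⟨ s≤s (⊓-glb (≤-trans (palLen-suc≤ K) (n≤1+n _)) (shift≤ (palLen (suc K)))) ⟩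
    3 + (palLen K ⊓ palLen (suc K))             ≡⟨ cong suc (palLen-4k+2 K) ⟨
    suc (palLen (2 + K * 4))                    ∎
    where open ≤-Reasoning
  ... | 4k+3 K = begin
    palLen (2 + suc K * 4)                      ≡⟨ palLen-4k+2 (suc K) ⟩
    2 + (palLen (suc K) ⊓ palLen (suc (suc K))) ≤⟨ s≤s (s≤s (m⊓n≤m _ _)) ⟩
    suc (suc (palLen (suc K)))                  ≡⟨ cong suc (palLen-4k+3 K) ⟨
    suc (palLen (3 + K * 4))                    ∎
    where open ≤-Reasoning

  long-4k+0 : ∀ I J D → PalBound (blocks s) (J * 4) → 4 + I * 4 ≤ J * 4 → I * 4 + J * 4 ≡ D * 4 →
              PalFactor s (I * 4) (J * 4) → palLen (J * 4) ≤ suc (palLen (I * 4))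
  long-4k+0 I J D bound 4+i≤j i+j≡D*4 pal = begin
    palLen (J * 4)       ≡⟨ palLen-4k J ⟩
    palLen J             ≤⟨ bound (<⇒≤ I<J) (k<k*4 (≤-trans (s≤s z≤n) I<J)) blockPal ⟩
    suc (palLen I)       ≡⟨ cong suc (palLen-4k I) ⟨
    suc (palLen (I * 4)) ∎
    where
    open ≤-Reasoning
    I<J : I < J
    I<J = ≤-quotient {r = 0} (s≤s z≤n) 4+i≤j
    I+J≡D : I + J ≡ D
    I+J≡D = *-cancelʳ-≡ (I + J) D 4 (trans (*-distribʳ-+ 4 I J) i+j≡D*4)
    blockPal : PalFactor (blocks s) I J
    blockPal = palFactor-block pal i+j≡D*4 I+J≡D (shift≤ (I * 4))

  long-4k+1 : ∀ I J D → PalBound (blocks s) (3 + J * 4) → 5 + I * 4 ≤ 3 + J * 4 → (1 + I * 4) + (3 + J * 4) ≡ D * 4 →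
              PalFactor s (1 + I * 4) (3 + J * 4) → palLen (3 + J * 4) ≤ suc (palLen (1 + I * 4))
  long-4k+1 I J D bound 4+i≤j i+j≡D*4 pal = begin
    palLen (3 + J * 4)        ≡⟨ palLen-4k+3 J ⟩
    suc (palLen (suc J))      ≤⟨ s≤s (bound (≤-trans I≤J (n≤1+n J)) (s≤s (k<1+r+k*4 1 J)) blockPal) ⟩
    suc (suc (palLen I))      ≡⟨ cong suc (palLen-4k+1 I) ⟨
    suc (palLen (1 + I * 4))  ∎
    where
    open ≤-Reasoning
    I≤J : I ≤ J
    I≤J = ≤-quotient {r = 3} (s≤s (s≤s (s≤s (s≤s z≤n)))) (≤-trans (m≤n+m (I * 4) 5) 4+i≤j)
    blockPal : PalFactor (blocks s) I (suc J)
    blockPal = palFactor-block pal i+j≡D*4 (trans (+-suc I J) (blockSum 1 3 I J D refl i+j≡D*4)) (shift≤ (I * 4))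

  long-4k+2 : ∀ I J D → PalBound (blocks s) (2 + J * 4) → 6 + I * 4 ≤ 2 + J * 4 → (2 + I * 4) + (2 + J * 4) ≡ D * 4 →
              PalFactor s (2 + I * 4) (2 + J * 4) → palLen (2 + J * 4) ≤ suc (palLen (2 + I * 4))
  long-4k+2 I J D bound 4+i≤j i+j≡D*4 pal = begin
    palLen (2 + J * 4)                      ≡⟨ palLen-4k+2 J ⟩
    2 + (palLen J ⊓ palLen (suc J))
      ≤⟨ s≤s (s≤s (⊓-glb (≤-trans (m⊓n≤n _ _) left) (≤-trans (m⊓n≤m _ _) right))) ⟩
    3 + (palLen I ⊓ palLen (suc I))         ≡⟨ cong suc (palLen-4k+2 I) ⟨
    suc (palLen (2 + I * 4))                ∎
    where
    open ≤-Reasoning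
    I<J : I < J
    I<J = ≤-quotient {r = 2} (s≤s (s≤s (s≤s z≤n))) (≤-trans (m≤n+m (suc I * 4) 2) 4+i≤j)
    1+I+J≡D : suc (I + J) ≡ D
    1+I+J≡D = blockSum 2 2 I J D refl i+j≡D*4
    left : palLen (suc J) ≤ suc (palLen I)
    left = bound (≤-trans (<⇒≤ I<J) (n≤1+n J)) (s≤s (s≤s (m≤m*n J 4)))
      (palFactor-block pal i+j≡D*4 (trans (+-suc I J) 1+I+J≡D) ≤-refl)
    right : palLen J ≤ suc (palLen (suc I))
    right = bound I<J (k<1+r+k*4 1 J) (palFactor-block pal i+j≡D*4 1+I+J≡D (shift≤ (I * 4)))

  long-4k+3 : ∀ I J D → PalBound (blocks s) (1 + J * 4) → 7 + I * 4 ≤ 1 + J * 4 → (3 + I * 4) + (1 + J * 4) ≡ D * 4 →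
              PalFactor s (3 + I * 4) (1 + J * 4) → palLen (1 + J * 4) ≤ suc (palLen (3 + I * 4))
  long-4k+3 I J D bound 4+i≤j i+j≡D*4 pal = begin
    palLen (1 + J * 4)         ≡⟨ palLen-4k+1 J ⟩
    suc (palLen J)             ≤⟨ s≤s (bound I<J (k<1+r+k*4 0 J) blockPal) ⟩
    suc (suc (palLen (suc I))) ≡⟨ cong suc (palLen-4k+3 I) ⟨
    suc (palLen (3 + I * 4))   ∎
    where
    open ≤-Reasoning
    I<J : I < J
    I<J = ≤-quotient {r = 1} (s≤s (s≤s z≤n)) (≤-trans (m≤n+m (suc I * 4) 3) 4+i≤j)
    blockPal : PalFactor (blocks s) (suc I) J
    blockPal = palFactor-block pal i+j≡D*4 (blockSum 3 1 I J D refl i+j≡D*4) (shift≤ (I * 4))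

  -- A long palindrome is centred at a block boundary and covers, up to its ends, a palindrome of blocks s.
  palLen-long : ∀ {i j} → PalBound (blocks s) j → 4 + i ≤ j → 4 ∣ i + j →
                PalFactor s i j → palLen j ≤ suc (palLen i)
  palLen-long {i} {j} bound 4+i≤j 4∣i+j@(divides D i+j≡D*4) with mod4Mirror i j 4∣i+j
  ... | mirror00 I J = long-4k+0 I J D bound 4+i≤j i+j≡D*4
  ... | mirror13 I J = long-4k+1 I J D bound 4+i≤j i+j≡D*4
  ... | mirror22 I J = long-4k+2 I J D bound 4+i≤j i+j≡D*4
  ... | mirror31 I J = long-4k+3 I J D bound 4+i≤j i+j≡D*4

  palLen-palFactor : ∀ {i j} → PalBound (blocks s) j → i ≤ j → PalFactor s i j → palLen j ≤ suc (palLen i)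
  palLen-palFactor {i} {j} bound i≤j pal with j ∸ i | m∸n+n≡m i≤j
  ... | 0 | refl = n≤1+n _
  ... | 1 | refl = palLen-suc≤ i
  ... | 2 | refl = palLen-length2 i pal
  ... | 3 | refl = palLen-length3 i pal
  ... | suc (suc (suc (suc L))) | refl =
    palLen-long bound (s≤s (s≤s (s≤s (s≤s (m≤n+m i L))))) (palFactor-centre L i pal) pal

  shortChain-4k : ∀ K → ShortChain (blocks s) K → ShortChain s (K * 4)
  shortChain-4k K (k , chain , k≤) = k , palChain-unblock chain , ≤-trans k≤ (≤-reflexive (sym (palLen-4k K)))

  shortChain-4k+1 : ∀ K → ShortChain (blocks s) K → ShortChain s (1 + K * 4)
  shortChain-4k+1 K (k , chain , k≤) =
    suc k , palChain-snocLetter (palChain-unblock chain) , ≤-trans (s≤s k≤) (≤-reflexive (sym (palLen-4k+1 K)))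

  shortChain-4k+2ˡ : ∀ K → palLen K ≤ palLen (suc K) → ShortChain (blocks s) K → ShortChain s (2 + K * 4)
  shortChain-4k+2ˡ K K≤K+1 (k , chain , k≤) = 2 + k , palChain-snocLetter (palChain-snocLetter (palChain-unblock chain)) ,
    ≤-trans (s≤s (s≤s k≤)) (≤-reflexive (sym (palLen-4k+2ˡ K K≤K+1)))

  -- The last factor of the chain for blocks s, unblocked, loses its first two letters to single-letter factors.
  shortChain-4k+2ʳ : ∀ K → palLen (suc K) ≤ palLen K → ShortChain (blocks s) (suc K) → ShortChain s (2 + K * 4)
  shortChain-4k+2ʳ K K+1≤K (suc k , snoc {M} chain M<K+1 pal , k<K+1) with m≤n⇒m<n∨m≡n (≤-pred M<K+1)
  ... | inj₁ M<K = 3 + k ,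
    snoc (palChain-snocLetter (palChain-snocLetter (palChain-unblock chain))) (s≤s (s≤s (*-monoˡ-< 4 M<K)))
      (palFactor-inner (palFactor-inner (palFactor-unblock pal))) ,
    ≤-trans (s≤s (s≤s k<K+1)) (≤-reflexive (sym (palLen-4k+2ʳ K K+1≤K)))
  ... | inj₂ refl = 2 + k , palChain-snocLetter (palChain-snocLetter (palChain-unblock chain)) ,
    ≤-trans (s≤s (s≤s (≤-trans (n≤1+n k) k<K+1))) (≤-reflexive (sym (palLen-4k+2ʳ K K+1≤K)))

  shortChain-4k+3 : ∀ K → ShortChain (blocks s) (suc K) → ShortChain s (3 + K * 4)
  shortChain-4k+3 K (suc k , snoc {M} chain M<K+1 pal , k<K+1) = 2 + k ,
    snoc (palChain-snocLetter (palChain-unblock chain)) (s≤s (s≤s (≤-trans (*-monoˡ-≤ 4 (≤-pred M<K+1)) (n≤1+n _))))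
      (palFactor-inner (palFactor-unblock pal)) ,
    ≤-trans (s≤s k<K+1) (≤-reflexive (sym (palLen-4k+3 K)))

-- The class and its blocks

-- The class C over any alphabet, with injective letter maps f n in place of bijections.
record InClass (s : ℕ → A) : Set where
  field
    a : A
    f : ℕ → A → A
    f-injective : ∀ n {x y} → f n x ≡ f n y → x ≡ y
    w : ℕ → List A
    w-zero : w 0 ≡ [ a ]
    w-suc : ∀ n → w (suc n) ≡ w n ++ map (f n) (w n) ++ map (f n) (w n) ++ w n
    f-moves : ∀ n → map (f n) (w n) ≢ w n
    w-prefix : ∀ n → applyUpTo s (length (w n)) ≡ w n

unblockWord : List (A × A) → List A
unblockWord []            = []
unblockWord ((x , y) ∷ u) = x ∷ y ∷ y ∷ x ∷ unblockWord u

unblockWord-++ : ∀ (u v : List (A × A)) → unblockWord (u ++ v) ≡ unblockWord u ++ unblockWord v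
unblockWord-++ []            v = refl
unblockWord-++ ((x , y) ∷ u) v = cong (λ z → x ∷ y ∷ y ∷ x ∷ z) (unblockWord-++ u v)

map-unblockWord : ∀ (h : A → A) u → map h (unblockWord u) ≡ unblockWord (map (Product.map h h) u)
map-unblockWord h []            = refl
map-unblockWord h ((x , y) ∷ u) = cong (λ z → h x ∷ h y ∷ h y ∷ h x ∷ z) (map-unblockWord h u)

unblockWord-prefix : ∀ (s : ℕ → A) u → applyUpTo s (length (unblockWord u)) ≡ unblockWord u →
                     applyUpTo (blocks s) (length u) ≡ u
unblockWord-prefix s []            _  = refl
unblockWord-prefix s ((x , y) ∷ u) eq with ∷-injective eq
... | x≡ , eq₁ with ∷-injective eq₁
... | y≡ , eq₂ = cong₂ _∷_ (cong₂ _,_ x≡ y≡)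
  (unblockWord-prefix (λ t → s (4 + t)) u (∷-injectiveʳ (∷-injectiveʳ eq₂)))

Distinct : A × A → Set
Distinct (x , y) = x ≢ y

unblockWord-blocked : ∀ (s : ℕ → A) u → applyUpTo s (length (unblockWord u)) ≡ unblockWord u → All Distinct u →
  ∀ K → K < length u → s (2 + K * 4) ≡ s (1 + K * 4) × s (3 + K * 4) ≡ s (K * 4) × s (K * 4) ≢ s (1 + K * 4)
unblockWord-blocked s ((x , y) ∷ u) eq distinct zero _ with ∷-injective eq
... | x≡ , eq₁ with ∷-injective eq₁
... | y≡ , eq₂ with ∷-injective eq₂
... | y≡′ , eq₃ with ∷-injective eq₃
... | x≡′ , _ =
  trans y≡′ (sym y≡) , trans x≡′ (sym x≡) , λ x=y → All.head distinct (trans (sym x≡) (trans x=y y≡))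
unblockWord-blocked s (_ ∷ u) eq distinct (suc K) (s≤s K<) =
  unblockWord-blocked (λ t → s (4 + t)) u (∷-injectiveʳ (∷-injectiveʳ (∷-injectiveʳ (∷-injectiveʳ eq))))
    (All.tail distinct) K K<

module _ {s : ℕ → A} (c : InClass s) where
  open InClass c

  blockMap : ℕ → A × A → A × A
  blockMap n = Product.map (f (suc n)) (f (suc n))

  blockWord : ℕ → List (A × A)
  blockWord zero    = [ (a , f 0 a) ]
  blockWord (suc n) = blockWord n ++ map (blockMap n) (blockWord n) ++ map (blockMap n) (blockWord n) ++ blockWord n

  w-unblockWord : ∀ n → w (suc n) ≡ unblockWord (blockWord n)
  w-unblockWord zero    = trans (w-suc 0) (cong (λ u → u ++ map (f 0) u ++ map (f 0) u ++ u) w-zero)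
  w-unblockWord (suc n) = begin
    w (suc (suc n))                                ≡⟨ w-suc (suc n) ⟩
    W ++ map h W ++ map h W ++ W                   ≡⟨ cong (λ x → x ++ map h x ++ map h x ++ x) (w-unblockWord n) ⟩
    U ++ map h U ++ map h U ++ U                   ≡⟨ cong (λ x → U ++ x ++ x ++ U) (map-unblockWord h u) ⟩
    U ++ unblockWord hu ++ unblockWord hu ++ U     ≡⟨ cong (U ++_) (cong (unblockWord hu ++_) (unblockWord-++ hu u)) ⟨
    U ++ unblockWord hu ++ unblockWord (hu ++ u)   ≡⟨ cong (U ++_) (unblockWord-++ hu (hu ++ u)) ⟨
    U ++ unblockWord (hu ++ hu ++ u)               ≡⟨ unblockWord-++ u (hu ++ hu ++ u) ⟨
    unblockWord (blockWord (suc n))                ∎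
    where
    open ≡-Reasoning
    W = w (suc n)
    h = f (suc n)
    u = blockWord n
    U = unblockWord u
    hu = map (blockMap n) u

  unblockWord-blockWord-prefix : ∀ n → applyUpTo s (length (unblockWord (blockWord n))) ≡ unblockWord (blockWord n)
  unblockWord-blockWord-prefix n = subst (λ x → applyUpTo s (length x) ≡ x) (w-unblockWord n) (w-prefix (suc n))

  blockWord-prefix : ∀ n → applyUpTo (blocks s) (length (blockWord n)) ≡ blockWord n
  blockWord-prefix n = unblockWord-prefix s (blockWord n) (unblockWord-blockWord-prefix n)

  blockWord-distinct : ∀ n → All Distinct (blockWord n)
  blockWord-distinct zero    =
    (λ a≡fa → f-moves 0 (subst (λ x → map (f 0) x ≡ x) (sym w-zero) (cong [_] (sym a≡fa)))) All.∷ All.[]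
  blockWord-distinct (suc n) = ++⁺ distinct (++⁺ mapped (++⁺ mapped distinct))
    where
    distinct = blockWord-distinct n
    mapped = map⁺ (All.map (λ x≢y fx≡fy → x≢y (f-injective (suc n) fx≡fy)) distinct)

  n<length-blockWord : ∀ n → n < length (blockWord n)
  n<length-blockWord zero    = s≤s z≤n
  n<length-blockWord (suc n) = begin-strict
    suc n                                  ≤⟨ n<length-blockWord n ⟩
    length u                               <⟨ m<m+n (length u) (<-≤-trans (≤-<-trans z≤n (n<length-blockWord n)) u≤rest) ⟩
    length u + length rest                 ≡⟨ length-++ u ⟨
    length (blockWord (suc n))             ∎
    where
    open ≤-Reasoning
    u = blockWord n
    rest = map (blockMap n) u ++ map (blockMap n) u ++ u
    u≤rest : length u ≤ length rest
    u≤rest = ≤-trans (≤-reflexive (sym (length-map (blockMap n) u))) (length-++-≤ˡ (map (blockMap n) u))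

  inClass-blocked : Blocked s
  inClass-blocked = record
    { letter-2 = λ K → proj₁ (facts K)
    ; letter-3 = λ K → proj₁ (proj₂ (facts K))
    ; letters-distinct = λ K → proj₂ (proj₂ (facts K))
    }
    where
    facts = λ K → unblockWord-blocked s (blockWord K) (unblockWord-blockWord-prefix K) (blockWord-distinct K)
      K (n<length-blockWord K)

  inClass-blocks : InClass (blocks s)
  inClass-blocks = record
    { a = a , f 0 a
    ; f = blockMap
    ; f-injective = λ n eq → ×-≡,≡→≡ (f-injective (suc n) (cong proj₁ eq) , f-injective (suc n) (cong proj₂ eq))
    ; w = blockWord
    ; w-zero = refl
    ; w-suc = λ n → refl
    ; f-moves = λ n eq → f-moves (suc n) (begin
        map (f (suc n)) (w (suc n))                          ≡⟨ cong (map (f (suc n))) (w-unblockWord n) ⟩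
        map (f (suc n)) (unblockWord (blockWord n))          ≡⟨ map-unblockWord (f (suc n)) (blockWord n) ⟩
        unblockWord (map (blockMap n) (blockWord n))         ≡⟨ cong unblockWord eq ⟩
        unblockWord (blockWord n)                            ≡⟨ w-unblockWord n ⟨
        w (suc n)                                            ∎)
    ; w-prefix = blockWord-prefix
    }
    where open ≡-Reasoning

-- Palindromic length of prefixes

palChain-short : ∀ n {A : Set} {s : ℕ → A} → InClass s → ShortChain s n
palChain-short = <-rec _ step
  where
  step : ∀ n → (∀ {m} → m < n → ∀ {A : Set} {s : ℕ → A} → InClass s → ShortChain s m) →
         ∀ {A : Set} {s : ℕ → A} → InClass s → ShortChain s n
  step n ih c with mod4 n
  ... | 4k+0 zero    = 0 , [] , z≤n
  ... | 4k+0 (suc K) = shortChain-4k (inClass-blocked c) (suc K) (ih (k<k*4 {suc K} (s≤s z≤n)) (inClass-blocks c))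
  ... | 4k+1 K       = shortChain-4k+1 (inClass-blocked c) K (ih (k<1+r+k*4 0 K) (inClass-blocks c))
  ... | 4k+2 K with palLen K ≤? palLen (suc K)
  ...   | yes K≤K+1 = shortChain-4k+2ˡ (inClass-blocked c) K K≤K+1 (ih (k<1+r+k*4 1 K) (inClass-blocks c))
  ...   | no K≰K+1  = shortChain-4k+2ʳ (inClass-blocked c) K (<⇒≤ (≰⇒> K≰K+1))
                          (ih (s≤s (s≤s (m≤m*n K 4))) (inClass-blocks c))
  step n ih c | 4k+3 K = shortChain-4k+3 (inClass-blocked c) K (ih (s≤s (k<1+r+k*4 1 K)) (inClass-blocks c))

palLen≤palChain : ∀ {s : ℕ → A} {n j k} → PalBound s n → PalChain s 0 j k → j < n → palLen j ≤ k
palLen≤palChain bound []                    _   = z≤n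
palLen≤palChain bound (snoc chain m<j pal) j<n =
  ≤-trans (bound (<⇒≤ m<j) j<n pal) (s≤s (palLen≤palChain bound chain (<-trans m<j j<n)))

palBound : ∀ n {A : Set} {s : ℕ → A} → InClass s → PalBound s n
palBound = <-rec _ step
  where
  step : ∀ n → (∀ {m} → m < n → ∀ {A : Set} {s : ℕ → A} → InClass s → PalBound s m) →
         ∀ {A : Set} {s : ℕ → A} → InClass s → PalBound s n
  step n ih {s = s} c {j = j} i≤j j<n = palLen-palFactor (inClass-blocked c) blocksBound i≤j
    where
    blocksBound : PalBound (blocks s) j
    blocksBound {I} {J} I≤J J<j pal with m≤n⇒m<n∨m≡n I≤J | palChain-short I (inClass-blocks c)
    ... | inj₂ refl | _               = n≤1+n _
    ... | inj₁ I<J  | k , chain , k≤ =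
      ≤-trans (palLen≤palChain (ih (≤-<-trans J<j j<n) (inClass-blocks c)) (snoc chain I<J pal) (n<1+n J)) (s≤s k≤)

-- Words and factorisations

prefix≡applyUpTo : ∀ (s : ℕ → A) n → prefix s n ≡ applyUpTo s n
prefix≡applyUpTo s zero    = refl
prefix≡applyUpTo s (suc n) = cong (s 0 ∷_) (prefix≡applyUpTo (λ t → s (suc t)) n)

applyUpTo-++ : ∀ (f : ℕ → A) a b → applyUpTo f (a + b) ≡ applyUpTo f a ++ applyUpTo (λ t → f (a + t)) b
applyUpTo-++ f zero    b = refl
applyUpTo-++ f (suc a) b = cong (f 0 ∷_) (applyUpTo-++ (λ t → f (suc t)) a b)

applyUpTo-cong : ∀ {f g : ℕ → A} L → (∀ {t} → t < L → f t ≡ g t) → applyUpTo f L ≡ applyUpTo g L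
applyUpTo-cong zero    _   = refl
applyUpTo-cong (suc L) f≗g = cong₂ _∷_ (f≗g (s≤s z≤n)) (applyUpTo-cong L (λ t<L → f≗g (s≤s t<L)))

applyUpTo-injective : ∀ {f g : ℕ → A} L → applyUpTo f L ≡ applyUpTo g L → ∀ {t} → t < L → f t ≡ g t
applyUpTo-injective (suc L) eq {zero}  _         = proj₁ (∷-injective eq)
applyUpTo-injective (suc L) eq {suc t} (s≤s t<L) = applyUpTo-injective L (proj₂ (∷-injective eq)) t<L

applyDownFrom-mirror : ∀ (f : ℕ → A) L → applyDownFrom f L ≡ applyUpTo (λ t → f (L ∸ suc t)) L
applyDownFrom-mirror f zero    = refl
applyDownFrom-mirror f (suc L) = cong (f L ∷_) (applyDownFrom-mirror f L)

slice : (ℕ → A) → ℕ → ℕ → List A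
slice s i L = applyUpTo (λ t → s (i + t)) L

reverse-slice : ∀ (s : ℕ → A) i L → reverse (slice s i L) ≡ applyUpTo (λ t → s (i + (L ∸ suc t))) L
reverse-slice s i L = trans (reverse-applyUpTo _ L) (applyDownFrom-mirror _ L)

mirror-offsets : ∀ i t u L → suc ((i + t) + (i + u)) ≡ i + (i + L) → suc (t + u) ≡ L
mirror-offsets i t u L eq = +-cancelˡ-≡ (i + i) _ _ (trans (sym (regroup i t u)) (trans eq (sym (+-assoc i i L))))
  where
  regroup : ∀ i t u → suc ((i + t) + (i + u)) ≡ (i + i) + suc (t + u)
  regroup = solve-∀

isPalindrome⇒palFactor : ∀ (s : ℕ → A) i L → IsPalindrome (slice s i L) → PalFactor s i (i + L)
isPalindrome⇒palFactor s i L palindrome p q i≤p i≤q eq = begin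
  s p                          ≡⟨ cong s (m+[n∸m]≡n i≤p) ⟨
  s (i + t)                    ≡⟨ applyUpTo-injective L (trans (sym palindrome) (reverse-slice s i L)) t<L ⟩
  s (i + (L ∸ suc t))          ≡⟨ cong (λ x → s (i + (x ∸ suc t))) (sym t+u≡L) ⟩
  s (i + (suc (t + u) ∸ suc t)) ≡⟨ cong (λ x → s (i + x)) (m+n∸m≡n t u) ⟩
  s (i + u)                    ≡⟨ cong s (m+[n∸m]≡n i≤q) ⟩
  s q                          ∎
  where
  open ≡-Reasoning
  t = p ∸ i
  u = q ∸ i
  t+u≡L : suc (t + u) ≡ L
  t+u≡L = mirror-offsets i t u L (trans (cong₂ (λ x y → suc (x + y)) (m+[n∸m]≡n i≤p) (m+[n∸m]≡n i≤q)) eq)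
  t<L : t < L
  t<L = ≤-trans (s≤s (m≤m+n t u)) (≤-reflexive t+u≡L)

palFactor⇒isPalindrome : ∀ (s : ℕ → A) i L → PalFactor s i (i + L) → IsPalindrome (slice s i L)
palFactor⇒isPalindrome s i L pal = trans (reverse-slice s i L) (applyUpTo-cong L mirrored)
  where
  mirrored : ∀ {t} → t < L → s (i + (L ∸ suc t)) ≡ s (i + t)
  mirrored {t} t<L =
    pal _ _ (m≤m+n i _) (m≤m+n i t) (trans (regroup i (L ∸ suc t) t) (cong (λ x → i + (i + x)) (m∸n+n≡m t<L)))
    where
    regroup : ∀ i x t → suc ((i + x) + (i + t)) ≡ i + (i + (x + suc t))
    regroup = solve-∀

++≡applyUpTo : ∀ (f : ℕ → A) p rest L → p ++ rest ≡ applyUpTo f L →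
  ∃[ b ] length p + b ≡ L × p ≡ applyUpTo f (length p) × rest ≡ applyUpTo (λ t → f (length p + t)) b
++≡applyUpTo f []      rest L       eq = L , refl , refl , eq
++≡applyUpTo f (x ∷ p) rest (suc L) eq with ∷-injective eq
... | x≡ , eq′ with ++≡applyUpTo (λ t → f (suc t)) p rest L eq′
...   | b , p+b≡L , p≡ , rest≡ = b , cong suc p+b≡L , cong₂ _∷_ x≡ p≡ , rest≡

palChain-cons : ∀ {s : ℕ → A} {i m j k} → i < m → PalFactor s i m → PalChain s m j k → PalChain s i j (suc k)
palChain-cons i<m pal []                      = snoc [] i<m pal
palChain-cons i<m pal (snoc chain m<j pal′) = snoc (palChain-cons i<m pal chain) m<j pal′

palChain-factorisation : ∀ (s : ℕ → A) i L ps → PalFactorisation (slice s i L) ps →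
  ∃[ k ] PalChain s i (i + L) k × k ≤ length ps
palChain-factorisation s i zero    []       _ = 0 , subst (λ j → PalChain s i j 0) (sym (+-identityʳ i)) [] , z≤n
palChain-factorisation s i (suc L) []       (_ , ())
palChain-factorisation s i L       ([] ∷ ps) (pals , eq) with palChain-factorisation s i L ps (All.tail pals , eq)
... | k , chain , k≤ = k , chain , m≤n⇒m≤1+n k≤
palChain-factorisation s i L (p@(_ ∷ _) ∷ ps) (pals , eq) with ++≡applyUpTo _ p (concat ps) L eq
... | b , a+b≡L , p≡ , rest≡
  with palChain-factorisation s (i + length p) b ps
         (All.tail pals , trans rest≡ (applyUpTo-cong b (λ {t} _ → cong s (sym (+-assoc i (length p) t)))))
...   | k , chain , k≤ =
  suc k , subst (λ j → PalChain s i j (suc k)) end (palChain-cons (m<m+n i (s≤s z≤n)) first chain) , s≤s k≤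
  where
  first : PalFactor s i (i + length p)
  first = isPalindrome⇒palFactor s i (length p) (subst IsPalindrome p≡ (All.head pals))
  end : i + length p + b ≡ i + L
  end = trans (+-assoc i (length p) b) (cong (i +_) a+b≡L)

factorisation-palChain : ∀ {s : ℕ → A} {j k} → PalChain s 0 j k →
  ∃[ ps ] PalFactorisation (applyUpTo s j) ps × length ps ≡ k
factorisation-palChain [] = [] , (All.[] , refl) , refl
factorisation-palChain {s = s} {j} (snoc {m} {k = k} chain m<j pal) with j ∸ m | m+[n∸m]≡n (<⇒≤ m<j)
... | L | refl with factorisation-palChain chain
...   | ps , (pals , eq) , len = ps ++ [ slice s m L ] ,
  (++⁺ pals (palFactor⇒isPalindrome s m L pal All.∷ All.[]) , concat-last) ,
  trans (length-++ ps) (trans (+-comm (length ps) 1) (cong suc len))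
  where
  open ≡-Reasoning
  concat-last : concat (ps ++ [ slice s m L ]) ≡ applyUpTo s (m + L)
  concat-last = begin
    concat (ps ++ [ slice s m L ])          ≡⟨ concat-++ ps [ slice s m L ] ⟨
    concat ps ++ slice s m L ++ []          ≡⟨ cong₂ _++_ eq (++-identityʳ (slice s m L)) ⟩
    applyUpTo s m ++ slice s m L            ≡⟨ applyUpTo-++ s m L ⟨
    applyUpTo s (m + L)                     ∎

palLength-prefix : ∀ {s : ℕ → A} → InClass s → ∀ n {k} → PalLength (prefix s n) k → k ≡ palLen n
palLength-prefix {s = s} c n {k} ((ps , factorisation , length≡k) , minimal) = ≤-antisym upper lower
  where
  upper : k ≤ palLen n
  upper with palChain-short n c
  ... | k′ , chain , k′≤ with factorisation-palChain chain
  ...   | ps′ , (pals′ , eq′) , length≡k′ =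
    ≤-trans (minimal ps′ (pals′ , trans eq′ (sym (prefix≡applyUpTo s n)))) (≤-trans (≤-reflexive length≡k′) k′≤)
  lower : palLen n ≤ k
  lower with palChain-factorisation s 0 n ps (proj₁ factorisation , trans (proj₂ factorisation) (prefix≡applyUpTo s n))
  ... | k′ , chain , k′≤ =
    ≤-trans (palLen≤palChain (palBound (suc n) c) chain (n<1+n n)) (≤-trans k′≤ (≤-reflexive length≡k))

inC⇒inClass : ∀ {m} {s : ℕ → Fin m} → InC s → InClass s
inC⇒inClass {s = s} (a , f , moves , prefixes) = record
  { a = a
  ; f = λ n x → f n ⟨$⟩ʳ x
  ; f-injective = λ n {x} {y} eq → trans (sym (inverseˡ (f n))) (trans (cong (f n ⟨$⟩ˡ_) eq) (inverseˡ (f n)))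
  ; w = wseq a f
  ; w-zero = refl
  ; w-suc = λ n → refl
  ; f-moves = moves
  ; w-prefix = λ n → trans (sym (prefix≡applyUpTo s _)) (prefixes n)
  }

2+⊓-neighbour : ∀ a b → b ≤ suc a → a ≤ suc b → 2 + (a ⊓ b) ≡ b + 1 ⊎ 2 + (a ⊓ b) ≡ b + 2
2+⊓-neighbour a b b≤1+a a≤1+b with <-cmp a b
... | tri< a<b _ _  =
  inj₁ (trans (cong (2 +_) (m≤n⇒m⊓n≡m (<⇒≤ a<b))) (trans (cong suc (≤-antisym a<b b≤1+a)) (+-comm 1 b)))
... | tri≈ _ refl _ = inj₂ (trans (cong (2 +_) (⊓-idem a)) (+-comm 2 a))
... | tri> _ _ b<a  = inj₂ (trans (cong (2 +_) (m≥n⇒m⊓n≡n (<⇒≤ b<a))) (+-comm 2 b))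

suc-neighbour : ∀ a b → b ≤ suc a → a ≤ suc b → suc a ≡ b ⊎ suc a ≡ b + 1 ⊎ suc a ≡ b + 2
suc-neighbour a b b≤1+a a≤1+b with <-cmp a b
... | tri< a<b _ _  = inj₁ (≤-antisym a<b b≤1+a)
... | tri≈ _ refl _ = inj₂ (inj₁ (+-comm 1 a))
... | tri> _ _ b<a  = inj₂ (inj₂ (trans (cong suc (≤-antisym a≤1+b b<a)) (+-comm 2 b)))

1+[4*k+r]≡1+r+k*4 : ∀ r k → suc (4 * k + r) ≡ suc r + k * 4
1+[4*k+r]≡1+r+k*4 = solve-∀

1+4*k≡1+k*4 : ∀ k → suc (4 * k) ≡ 1 + k * 4
1+4*k≡1+k*4 = solve-∀

palLen-corollary : ∀ k →
  (palLen (4 + k * 4) ≡ palLen (suc k)) ×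
  (palLen (3 + k * 4) ≡ palLen (4 + k * 4) + 1) ×
  (palLen (2 + k * 4) ≡ palLen (4 + k * 4) + 1 ⊎ palLen (2 + k * 4) ≡ palLen (4 + k * 4) + 2) ×
  (palLen (1 + k * 4) ≡ palLen (4 + k * 4) ⊎ palLen (1 + k * 4) ≡ palLen (4 + k * 4) + 1 ⊎
   palLen (1 + k * 4) ≡ palLen (4 + k * 4) + 2)
palLen-corollary k rewrite palLen-4k (suc k) | palLen-4k+3 k | palLen-4k+2 k | palLen-4k+1 k =
  refl ,
  +-comm 1 (palLen (suc k)) ,
  2+⊓-neighbour (palLen k) (palLen (suc k)) (palLen-suc≤ k) (palLen≤suc k) ,
  suc-neighbour (palLen k) (palLen (suc k)) (palLen-suc≤ k) (palLen≤suc k)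

pl≡palLen : ∀ {m} (s : ℕ → Fin m) → InC s → ∀ n {q r} → suc n ≡ r → PL s n q → q ≡ palLen r
pl≡palLen s inC n 1+n≡r pl = trans (palLength-prefix (inC⇒inClass {s = s} inC) (suc n) pl) (cong palLen 1+n≡r)

corollary3 : (m : ℕ) → 2 ≤ m → (s : ℕ → Fin m) → InC s →
    (k p p0 p1 p2 p3 : ℕ) →
    PL s k p → PL s (4 * k) p0 → PL s (4 * k + 1) p1 →
    PL s (4 * k + 2) p2 → PL s (4 * k + 3) p3 →
    (p3 ≡ p) × (p2 ≡ p3 + 1) × (p1 ≡ p3 + 1 ⊎ p1 ≡ p3 + 2) ×
    (p0 ≡ p3 ⊎ p0 ≡ p3 + 1 ⊎ p0 ≡ p3 + 2)
corollary3 m _ s inC k p p0 p1 p2 p3 pl pl₀ pl₁ pl₂ pl₃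
  with pl≡palLen s inC k refl pl
     | pl≡palLen s inC (4 * k) (1+4*k≡1+k*4 k) pl₀
     | pl≡palLen s inC (4 * k + 1) (1+[4*k+r]≡1+r+k*4 1 k) pl₁
     | pl≡palLen s inC (4 * k + 2) (1+[4*k+r]≡1+r+k*4 2 k) pl₂
     | pl≡palLen s inC (4 * k + 3) (1+[4*k+r]≡1+r+k*4 3 k) pl₃
... | refl | refl | refl | refl | refl = palLen-corollary k
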